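{- Let $|A|>1$ and let $E$ be an inequational axiomatization over $\mathrm{BCCS}(A)$ that is sound for $\sqsubseteq_{\rm WIF}$. Let $v,w$ be terms, $a\in A$ and $m$ an integer such that (1) $v\preccurlyeq w$ is derivable from $E$; (2) $m\ge|u|$ for every inequation $t\preccurlyeq u$ in $E$; (3) $v\Rightarrow\xrightarrow{\tau}\hat v$ for a term $\hat v$ that has no trace $ax$ with $x\in V$ and no trace $a^mb$ with $b\in A$. Then $w\Rightarrow\xrightarrow{\tau}\hat w$ for a term $\hat w$ that has no trace $ax$ with $x\in V$ and no trace $a^mb$ with $b\in A$.
   Context: $\mathrm{BCCS}(A)$: $A$ nonempty set of visible actions, $\tau\notin A$, countably infinite variable set $V$; terms $t::=\mathbf{0}\mid\alpha t\mid t+t\mid x$, $\alpha\in A\cup\{\tau\}$. Depth: $|\mathbf{0}|=|x|=0$, $|bt|=1+|t|$ ($b\in A$), $|\tau t|=|t|$, $|t+u|=\max(|t|,|u|)$. Transitions: $\alpha t\xrightarrow{\alpha}t$; if $t\xrightarrow{\alpha}t'$ then $t+u\xrightarrow{\alpha}t'$, $u+t\xrightarrow{\alpha}t'$; variables have no transitions. $\Rightarrow$: zero or more $\tau$-steps; $t\Rightarrow\xrightarrow{\tau}t'$ means $t\Rightarrow v\xrightarrow{\tau}t'$ for some $v$. Traces of closed $p_0$: $a_1\cdots a_k\in A^*$ with $p_0\Rightarrow\xrightarrow{a_1}\Rightarrow\cdots\Rightarrow\xrightarrow{a_k}\Rightarrow p_k$; set $\mathcal{T}(p_0)$. $(a_1\cdots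 a_k,B)$, $B\subseteq A^*$, is a weak impossible future of $p_0$ if such a path exists with $\mathcal{T}(p_k)\cap B=\emptyset$. $p\sqsubseteq_{\rm WIF}q$ iff (1) every weak impossible future of $p$ is one of $q$, (2) $\mathcal{T}(p)=\mathcal{T}(q)$, (3) $p\xrightarrow{\tau}$ implies $q\xrightarrow{\tau}$; for open terms via all closed substitutions. Traces of open terms: treat each variable occurrence $x$ as a subterm $x\mathbf{0}$ with $x$ a visible action, so traces lie in $A^*\cup A^*V$. Inequational logic: reflexivity, transitivity, substitution of terms for variables, closure under BCCS operators; an equation $t\approx u$ in $E$ abbreviates $t\preccurlyeq u$ and $u\preccurlyeq t$. $E$ is sound for $\sqsubseteq_{\rm WIF}$ if every derivable $t\preccurlyeq u$ satisfies $t\sqsubseteq_{\rm WIF}u$. $a^m$ is $m$ copies of $a$. -}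

module Defs where

open import Data.Nat using (ℕ; zero; suc; _⊔_)
open import Data.List using (List; []; _∷_; _++_; replicate)
open import Data.Product using (Σ; ∃; _×_; _,_)
open import Data.Sum using (_⊎_)
open import Relation.Nullary using (¬_)

module BCCS (A : Set) where

  data Act : Set where
    τ   : Act
    vis : A → Act

  data Term : Set where
    𝟎    : Term
    _·_  : Act → Term → Term
    _⊕_  : Term → Term → Term
    var  : ℕ → Term

  infixr 7 _·_
  infixl 6 _⊕_

  depth : Term → ℕ
  depth 𝟎 = 0
  depth (var x) = 0
  depth (vis b · t) = suc (depth t)
  depth (τ · t) = depth t
  depth (t ⊕ u) = depth t ⊔ depth u

  Subst : Set
  Subst = ℕ → Term

  _[_] : Term → Subst → Term
  𝟎 [ σ ] = 𝟎
  (α · t) [ σ ] = α · (t [ σ ])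
  (t ⊕ u) [ σ ] = (t [ σ ]) ⊕ (u [ σ ])
  var x [ σ ] = σ x

  data Closed : Term → Set where
    𝟎c : Closed 𝟎
    ·c : ∀ {α t} → Closed t → Closed (α · t)
    ⊕c : ∀ {t u} → Closed t → Closed u → Closed (t ⊕ u)

  ClosedSubst : Subst → Set
  ClosedSubst σ = ∀ x → Closed (σ x)

  data _─[_]→_ : Term → Act → Term → Set where
    pre  : ∀ {α t} → (α · t) ─[ α ]→ t
    sumˡ : ∀ {t u α t'} → t ─[ α ]→ t' → (t ⊕ u) ─[ α ]→ t'
    sumʳ : ∀ {t u α t'} → t ─[ α ]→ t' → (u ⊕ t) ─[ α ]→ t'

  data _⇒_ : Term → Term → Set where
    ⇒-refl : ∀ {t} → t ⇒ t
    ⇒-step : ∀ {t t₁ t'} → t ─[ τ ]→ t₁ → t₁ ⇒ t' → t ⇒ t'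

  _⇒τ_ : Term → Term → Set
  t ⇒τ t' = ∃ λ v → (t ⇒ v) × (v ─[ τ ]→ t')

  data WPath : Term → List A → Term → Set where
    done : ∀ {t t'} → t ⇒ t' → WPath t [] t'
    step : ∀ {t t₁ t₂ t' a s} → t ⇒ t₁ → t₁ ─[ vis a ]→ t₂ → WPath t₂ s t' →
           WPath t (a ∷ s) t'

  HasTrace : Term → List A → Set
  HasTrace t s = ∃ λ t' → WPath t s t'

  -- variable occurrence x as a summand (i.e. x·𝟎 can perform the visible action x)
  data HasVar : Term → ℕ → Set where
    here : ∀ {x} → HasVar (var x) x
    inˡ  : ∀ {t u x} → HasVar t x → HasVar (t ⊕ u) x
    inʳ  : ∀ {t u x} → HasVar u x → HasVar (t ⊕ u) x

  -- s x ∈ A* V is a trace of the open term t (treating x as x·𝟎)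
  HasVarTrace : Term → List A → ℕ → Set
  HasVarTrace t s x = ∃ λ t' → WPath t s t' × HasVar t' x

  WIF : Term → List A → (List A → Set) → Set
  WIF p s B = ∃ λ p' → WPath p s p' × (∀ u → B u → ¬ HasTrace p' u)

  _⊑c_ : Term → Term → Set₁
  p ⊑c q = (∀ s (B : List A → Set) → WIF p s B → WIF q s B)
         × (∀ s → (HasTrace p s → HasTrace q s) × (HasTrace q s → HasTrace p s))
         × ((∃ λ p' → p ─[ τ ]→ p') → ∃ λ q' → q ─[ τ ]→ q')

  _⊑WIF_ : Term → Term → Set₁
  t ⊑WIF u = ∀ σ → ClosedSubst σ → (t [ σ ]) ⊑c (u [ σ ])

  -- inequational logic: E is a set of inequations t ≼ u
  -- (an equation t ≈ u in E is represented by both t ≼ u and u ≼ t)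
  data Derivable (E : Term → Term → Set) : Term → Term → Set where
    ax    : ∀ {t u} → E t u → Derivable E t u
    refl  : ∀ {t} → Derivable E t t
    trans : ∀ {t u v} → Derivable E t u → Derivable E u v → Derivable E t v
    subst : ∀ {t u} (σ : Subst) → Derivable E t u → Derivable E (t [ σ ]) (u [ σ ])
    pref  : ∀ {t u} (α : Act) → Derivable E t u → Derivable E (α · t) (α · u)
    plus  : ∀ {t t' u u'} → Derivable E t u → Derivable E t' u' →
            Derivable E (t ⊕ t') (u ⊕ u')

  Sound : (Term → Term → Set) → Set₁
  Sound E = ∀ t u → Derivable E t u → t ⊑WIF u

  NoBadTrace : A → ℕ → Term → Set
  NoBadTrace a m t = (∀ x → ¬ HasVarTrace t (a ∷ []) x)
                   × (∀ b → ¬ HasTrace t (replicate m a ++ b ∷ []))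

-- Induction on the derivation, generalised over a substitution σ applied to both sides so that
-- the substitution rule goes through.  For an axiom t ≼ u, soundness is applied to the closed
-- substitution sending z to c dᴷ⁺ᶻ c·𝟎, with K at least the depth of the term to be decoded: its maximal
-- trace is longer than any trace of that term and identifies z, so trace inclusions between the
-- instances become inclusions between the variable traces s z of the open terms.  If t ⇒τ t̂, the
-- weak impossible future ([] , traces not of t̂) yields u ⇒ û whose variable traces are among
-- those of t̂, while depth û ≤ m rules out new traces aᵐb; if û = u, clause (3) of ⊑WIF gives u a
-- τ-step.
module Submission where

open import Defs
open import Data.Nat using (ℕ; _≤_)
open import Data.Product using (∃; _×_)
open import Relation.Binary.PropositionalEquality using (_≢_)

open import Data.Nat using (zero; suc; _+_; _<_; z≤n; s≤s)
open import Data.Nat.Properties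
  using (≤-refl; ≤-trans; m≤m+n; m<n⇒m<1+n; +-cancelˡ-≡; <⇒≱; m≤m⊔n; m≤n⊔m; n≤1+n)
open import Data.List using (List; []; _∷_; _++_; replicate; length)
open import Data.List.Properties
  using (length-replicate; ++-identityʳ; ++-assoc; ∷-injective; ∷ʳ-injectiveˡ)
open import Data.List.Membership.Propositional using (_∉_)
open import Data.List.Membership.Propositional.Properties using (∈-++⁺ʳ)
open import Data.List.Relation.Unary.Any using (here; there)
open import Data.Product using (_,_; proj₁; proj₂; map₁; map₂)
open import Data.Sum using (_⊎_; inj₁; inj₂)
open import Data.Empty using (⊥-elim)
open import Function using (_∘_; const)
open import Relation.Nullary using (¬_)
open import Relation.Binary.PropositionalEquality as Eq using (_≡_; refl; cong; cong₂; sym)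

++-∷-injective : ∀ {X : Set} {x : X} (s t : List X) {xs ys} → x ∉ xs → x ∉ ys →
                 s ++ x ∷ xs ≡ t ++ x ∷ ys → s ≡ t × xs ≡ ys
++-∷-injective []      []      _    _    refl = refl , refl
++-∷-injective []      (_ ∷ t) x∉xs _    refl = ⊥-elim (x∉xs (∈-++⁺ʳ t (here refl)))
++-∷-injective (_ ∷ s) []      _    x∉ys refl = ⊥-elim (x∉ys (∈-++⁺ʳ s (here refl)))
++-∷-injective (x ∷ s) (_ ∷ t) x∉xs x∉ys e with ∷-injective e
... | refl , e′ = map₁ (cong (x ∷_)) (++-∷-injective s t x∉xs x∉ys e′)

<-length-replicate-∷ : ∀ {X : Set} n {x y : X} ys → n < length (replicate n x ++ y ∷ ys)
<-length-replicate-∷ zero    ys = s≤s z≤n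
<-length-replicate-∷ (suc n) ys = s≤s (<-length-replicate-∷ n ys)

<-length-∷-replicate : ∀ {X : Set} (s : List X) n {x y : X} ys →
                       n < length (s ++ x ∷ replicate n y ++ ys)
<-length-∷-replicate (_ ∷ s) n       {x} {y} ys = m<n⇒m<1+n (<-length-∷-replicate s n {x} {y} ys)
<-length-∷-replicate []      zero            ys = s≤s z≤n
<-length-∷-replicate []      (suc n) {x} {y} ys = s≤s (<-length-∷-replicate [] n {x} {y} ys)

module Semantics (A : Set) where
  open BCCS A

  ⇒-trans : ∀ {p q r} → p ⇒ q → q ⇒ r → p ⇒ r
  ⇒-trans ⇒-refl        q⇒r = q⇒r
  ⇒-trans (⇒-step st r) q⇒r = ⇒-step st (⇒-trans r q⇒r)

  ⇒-WPath : ∀ {p p′ s q} → p ⇒ p′ → WPath p′ s q → WPath p s q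
  ⇒-WPath p⇒p′ (done r)      = done (⇒-trans p⇒p′ r)
  ⇒-WPath p⇒p′ (step r st w) = step (⇒-trans p⇒p′ r) st w

  WPath-++ : ∀ {p s p′ r q} → WPath p s p′ → WPath p′ r q → WPath p (s ++ r) q
  WPath-++ (done r)      w′ = ⇒-WPath r w′
  WPath-++ (step r st w) w′ = step r st (WPath-++ w w′)

  ⇒τ⇒⇒ : ∀ {t t′} → t ⇒τ t′ → t ⇒ t′
  ⇒τ⇒⇒ (_ , r , st) = ⇒-trans r (⇒-step st ⇒-refl)

  ⇒-⇒τ : ∀ {t t₁ t′} → t ⇒ t₁ → t₁ ⇒τ t′ → t ⇒τ t′
  ⇒-⇒τ t⇒t₁ (v , r , st) = v , ⇒-trans t⇒t₁ r , st

  ─τ→-⇒-⇒τ : ∀ {t t₁ t′} → t ─[ τ ]→ t₁ → t₁ ⇒ t′ → t ⇒τ t′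
  ─τ→-⇒-⇒τ st ⇒-refl          = _ , ⇒-refl , st
  ─τ→-⇒-⇒τ st (⇒-step st′ r) = ⇒-⇒τ (⇒-step st ⇒-refl) (─τ→-⇒-⇒τ st′ r)

  ⇒-split : ∀ {t t′} → t ⇒ t′ → t ≡ t′ ⊎ t ⇒τ t′
  ⇒-split ⇒-refl        = inj₁ refl
  ⇒-split (⇒-step st r) = inj₂ (─τ→-⇒-⇒τ st r)

  ⇒τ-head : ∀ {t t′} → t ⇒τ t′ → ∃ λ t₁ → t ─[ τ ]→ t₁
  ⇒τ-head (_ , ⇒-refl , st)      = _ , st
  ⇒τ-head (_ , ⇒-step st _ , _) = _ , st

  ⇒τ-⊕⁻ : ∀ {t u t′} → (t ⊕ u) ⇒τ t′ → t ⇒τ t′ ⊎ u ⇒τ t′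
  ⇒τ-⊕⁻ (_ , ⇒-refl , sumˡ st)          = inj₁ (_ , ⇒-refl , st)
  ⇒τ-⊕⁻ (_ , ⇒-refl , sumʳ st)          = inj₂ (_ , ⇒-refl , st)
  ⇒τ-⊕⁻ (v , ⇒-step (sumˡ st₁) r , st) = inj₁ (v , ⇒-step st₁ r , st)
  ⇒τ-⊕⁻ (v , ⇒-step (sumʳ st₁) r , st) = inj₂ (v , ⇒-step st₁ r , st)

  ⇒τ-⊕ˡ : ∀ {t u t′} → t ⇒τ t′ → (t ⊕ u) ⇒τ t′
  ⇒τ-⊕ˡ (_ , ⇒-refl , st)        = _ , ⇒-refl , sumˡ st
  ⇒τ-⊕ˡ (v , ⇒-step st₁ r , st) = v , ⇒-step (sumˡ st₁) r , st

  ⇒τ-⊕ʳ : ∀ {t u t′} → u ⇒τ t′ → (t ⊕ u) ⇒τ t′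
  ⇒τ-⊕ʳ (_ , ⇒-refl , st)        = _ , ⇒-refl , sumʳ st
  ⇒τ-⊕ʳ (v , ⇒-step st₁ r , st) = v , ⇒-step (sumʳ st₁) r , st

  depth-─→ : ∀ {t α t′} → t ─[ α ]→ t′ → depth t′ ≤ depth t
  depth-─→ (pre {τ})              = ≤-refl
  depth-─→ (pre {vis _})          = n≤1+n _
  depth-─→ (sumˡ {t} {u} st) = ≤-trans (depth-─→ st) (m≤m⊔n (depth t) (depth u))
  depth-─→ (sumʳ {t} {u} st) = ≤-trans (depth-─→ st) (m≤n⊔m (depth u) (depth t))

  depth-─vis→ : ∀ {t b t′} → t ─[ vis b ]→ t′ → depth t′ < depth t
  depth-─vis→ pre               = ≤-refl
  depth-─vis→ (sumˡ {t} {u} st) = ≤-trans (depth-─vis→ st) (m≤m⊔n (depth t) (depth u))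
  depth-─vis→ (sumʳ {t} {u} st) = ≤-trans (depth-─vis→ st) (m≤n⊔m (depth u) (depth t))

  depth-⇒ : ∀ {t t′} → t ⇒ t′ → depth t′ ≤ depth t
  depth-⇒ ⇒-refl        = ≤-refl
  depth-⇒ (⇒-step st r) = ≤-trans (depth-⇒ r) (depth-─→ st)

  length≤depth : ∀ {t s t′} → WPath t s t′ → length s ≤ depth t
  length≤depth (done _)      = z≤n
  length≤depth (step r st w) = ≤-trans (s≤s (length≤depth w)) (≤-trans (depth-─vis→ st) (depth-⇒ r))

  HasTrace-𝟎⁻ : ∀ {r} → HasTrace 𝟎 r → r ≡ []
  HasTrace-𝟎⁻ (_ , done _)                = refl
  HasTrace-𝟎⁻ (_ , step ⇒-refl () _)
  HasTrace-𝟎⁻ (_ , step (⇒-step () _) _ _)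

  HasTrace-vis·⁻ : ∀ {b t r} → HasTrace (vis b · t) r →
                   r ≡ [] ⊎ ∃ λ r′ → r ≡ b ∷ r′ × HasTrace t r′
  HasTrace-vis·⁻ (_ , done _)                = inj₁ refl
  HasTrace-vis·⁻ (q , step ⇒-refl pre w)     = inj₂ (_ , refl , q , w)
  HasTrace-vis·⁻ (_ , step (⇒-step () _) _ _)

  subst-∘ : ∀ t (σ σ′ : Subst) → (t [ σ ]) [ σ′ ] ≡ t [ (λ x → σ x [ σ′ ]) ]
  subst-∘ 𝟎       σ σ′ = refl
  subst-∘ (α · t) σ σ′ = cong (α ·_) (subst-∘ t σ σ′)
  subst-∘ (t ⊕ u) σ σ′ = cong₂ _⊕_ (subst-∘ t σ σ′) (subst-∘ u σ σ′)
  subst-∘ (var x) σ σ′ = refl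

  subst-identity : ∀ t → t [ var ] ≡ t
  subst-identity 𝟎       = refl
  subst-identity (α · t) = cong (α ·_) (subst-identity t)
  subst-identity (t ⊕ u) = cong₂ _⊕_ (subst-identity t) (subst-identity u)
  subst-identity (var x) = refl

  ─→-subst⁺ : ∀ {t α t′} (σ : Subst) → t ─[ α ]→ t′ → (t [ σ ]) ─[ α ]→ (t′ [ σ ])
  ─→-subst⁺ σ pre       = pre
  ─→-subst⁺ σ (sumˡ st) = sumˡ (─→-subst⁺ σ st)
  ─→-subst⁺ σ (sumʳ st) = sumʳ (─→-subst⁺ σ st)

  ⇒-subst⁺ : ∀ {t t′} (σ : Subst) → t ⇒ t′ → (t [ σ ]) ⇒ (t′ [ σ ])
  ⇒-subst⁺ σ ⇒-refl        = ⇒-refl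
  ⇒-subst⁺ σ (⇒-step st r) = ⇒-step (─→-subst⁺ σ st) (⇒-subst⁺ σ r)

  ⇒τ-subst⁺ : ∀ {t t′} (σ : Subst) → t ⇒τ t′ → (t [ σ ]) ⇒τ (t′ [ σ ])
  ⇒τ-subst⁺ σ (v , r , st) = v [ σ ] , ⇒-subst⁺ σ r , ─→-subst⁺ σ st

  WPath-subst⁺ : ∀ {t s t′} (σ : Subst) → WPath t s t′ → WPath (t [ σ ]) s (t′ [ σ ])
  WPath-subst⁺ σ (done r)      = done (⇒-subst⁺ σ r)
  WPath-subst⁺ σ (step r st w) = step (⇒-subst⁺ σ r) (─→-subst⁺ σ st) (WPath-subst⁺ σ w)

  HasTrace-subst⁺ : ∀ {t s} (σ : Subst) → HasTrace t s → HasTrace (t [ σ ]) s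
  HasTrace-subst⁺ σ (q , w) = q [ σ ] , WPath-subst⁺ σ w

  HasVar-subst⁺ : ∀ {t z x} (σ : Subst) → HasVar t z → HasVar (σ z) x → HasVar (t [ σ ]) x
  HasVar-subst⁺ σ here     hv = hv
  HasVar-subst⁺ σ (inˡ hz) hv = inˡ (HasVar-subst⁺ σ hz hv)
  HasVar-subst⁺ σ (inʳ hz) hv = inʳ (HasVar-subst⁺ σ hz hv)

  ─→-var : ∀ {t z α q} (σ : Subst) → HasVar t z → σ z ─[ α ]→ q → (t [ σ ]) ─[ α ]→ q
  ─→-var σ here     st = st
  ─→-var σ (inˡ hz) st = sumˡ (─→-var σ hz st)
  ─→-var σ (inʳ hz) st = sumʳ (─→-var σ hz st)

  ⇒τ-var : ∀ {t z q} (σ : Subst) → HasVar t z → σ z ⇒τ q → (t [ σ ]) ⇒τ q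
  ⇒τ-var σ hz (_ , ⇒-refl , st)        = _ , ⇒-refl , ─→-var σ hz st
  ⇒τ-var σ hz (v , ⇒-step st₁ r , st) = v , ⇒-step (─→-var σ hz st₁) r , st

  WPath-var : ∀ {t z r q} (σ : Subst) → HasVar t z → WPath (σ z) r q →
              WPath (t [ σ ]) r q ⊎ (r ≡ [] × q ≡ σ z)
  WPath-var σ hz (done ⇒-refl)             = inj₂ (refl , refl)
  WPath-var σ hz (done (⇒-step st r))      = inj₁ (done (⇒-step (─→-var σ hz st) r))
  WPath-var σ hz (step ⇒-refl st w)        = inj₁ (step ⇒-refl (─→-var σ hz st) w)
  WPath-var σ hz (step (⇒-step st₁ r) st w) = inj₁ (step (⇒-step (─→-var σ hz st₁) r) st w)

  HasTrace-subst-var : ∀ {t s z r} (σ : Subst) → HasVarTrace t s z → HasTrace (σ z) r →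
                       HasTrace (t [ σ ]) (s ++ r)
  HasTrace-subst-var σ (t′ , w , hz) (q , wz) with WPath-var σ hz wz
  ... | inj₁ wz′             = q , WPath-++ (WPath-subst⁺ σ w) wz′
  ... | inj₂ (refl , refl) = t′ [ σ ] , WPath-++ (WPath-subst⁺ σ w) (done ⇒-refl)

  HasVarTrace-subst-var : ∀ {t s z r x} (σ : Subst) → HasVarTrace t s z → HasVarTrace (σ z) r x →
                          HasVarTrace (t [ σ ]) (s ++ r) x
  HasVarTrace-subst-var σ (t′ , w , hz) (q , wz , hx) with WPath-var σ hz wz
  ... | inj₁ wz′             = q , WPath-++ (WPath-subst⁺ σ w) wz′ , hx
  ... | inj₂ (refl , refl) =
        t′ [ σ ] , WPath-++ (WPath-subst⁺ σ w) (done ⇒-refl) , HasVar-subst⁺ σ hz hx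

  HasVar-subst⁻ : ∀ t (σ : Subst) {x} → HasVar (t [ σ ]) x → ∃ λ z → HasVar t z × HasVar (σ z) x
  HasVar-subst⁻ (t ⊕ u) σ (inˡ hx) with HasVar-subst⁻ t σ hx
  ... | z , hz , hzx = z , inˡ hz , hzx
  HasVar-subst⁻ (t ⊕ u) σ (inʳ hx) with HasVar-subst⁻ u σ hx
  ... | z , hz , hzx = z , inʳ hz , hzx
  HasVar-subst⁻ (var y) σ hx = y , here , hx

  ─→-subst⁻ : ∀ {α q} t (σ : Subst) → (t [ σ ]) ─[ α ]→ q →
              (∃ λ t′ → t ─[ α ]→ t′ × q ≡ t′ [ σ ]) ⊎ (∃ λ z → HasVar t z × σ z ─[ α ]→ q)
  ─→-subst⁻ (β · t) σ pre       = inj₁ (t , pre , refl)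
  ─→-subst⁻ (t ⊕ u) σ (sumˡ st) with ─→-subst⁻ t σ st
  ... | inj₁ (t′ , st′ , e) = inj₁ (t′ , sumˡ st′ , e)
  ... | inj₂ (z , hz , st′) = inj₂ (z , inˡ hz , st′)
  ─→-subst⁻ (t ⊕ u) σ (sumʳ st) with ─→-subst⁻ u σ st
  ... | inj₁ (t′ , st′ , e) = inj₁ (t′ , sumʳ st′ , e)
  ... | inj₂ (z , hz , st′) = inj₂ (z , inʳ hz , st′)
  ─→-subst⁻ (var x) σ st = inj₂ (x , here , st)

  ⇒-subst⁻ : ∀ t (σ : Subst) {q} → (t [ σ ]) ⇒ q →
             (∃ λ t′ → t ⇒ t′ × q ≡ t′ [ σ ]) ⊎
             (∃ λ t′ → ∃ λ z → ∃ λ q₁ → t ⇒ t′ × HasVar t′ z × σ z ─[ τ ]→ q₁ × q₁ ⇒ q)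
  ⇒-subst⁻ t σ ⇒-refl = inj₁ (t , ⇒-refl , refl)
  ⇒-subst⁻ t σ (⇒-step st r) with ─→-subst⁻ t σ st
  ... | inj₂ (z , hz , st′) = inj₂ (t , z , _ , ⇒-refl , hz , st′ , r)
  ... | inj₁ (t₁ , st′ , refl) with ⇒-subst⁻ t₁ σ r
  ...   | inj₁ (t′ , r′ , e) = inj₁ (t′ , ⇒-step st′ r′ , e)
  ...   | inj₂ (t′ , z , q₁ , r′ , hz , st₁ , r₁) = inj₂ (t′ , z , q₁ , ⇒-step st′ r′ , hz , st₁ , r₁)

  ⇒τ-subst⁻ : ∀ t (σ : Subst) {q} → (t [ σ ]) ⇒τ q →
              (∃ λ t′ → t ⇒τ t′ × q ≡ t′ [ σ ]) ⊎
              (∃ λ t′ → ∃ λ z → t ⇒ t′ × HasVar t′ z × σ z ⇒τ q)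
  ⇒τ-subst⁻ t σ (v , r , st) with ⇒-subst⁻ t σ r
  ... | inj₂ (t′ , z , _ , r′ , hz , st₁ , r₁) = inj₂ (t′ , z , r′ , hz , v , ⇒-step st₁ r₁ , st)
  ... | inj₁ (t₁ , r′ , refl) with ─→-subst⁻ t₁ σ st
  ...   | inj₁ (t₂ , st′ , e) = inj₁ (t₂ , (t₁ , r′ , st′) , e)
  ...   | inj₂ (z , hz , st′) = inj₂ (t₁ , z , r′ , hz , σ z , ⇒-refl , st′)

  WPath-subst⁻ : ∀ t (σ : Subst) {w q} → WPath (t [ σ ]) w q →
                 (∃ λ t′ → WPath t w t′ × q ≡ t′ [ σ ]) ⊎
                 (∃ λ s → ∃ λ r → ∃ λ z → s ++ r ≡ w × HasVarTrace t s z × WPath (σ z) r q)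
  WPath-subst⁻ t σ (done r) with ⇒-subst⁻ t σ r
  ... | inj₁ (t′ , r′ , e) = inj₁ (t′ , done r′ , e)
  ... | inj₂ (t′ , z , _ , r′ , hz , st , r₁) =
        inj₂ ([] , [] , z , refl , (t′ , done r′ , hz) , done (⇒-step st r₁))
  WPath-subst⁻ t σ (step {a = b} {s = s} r st w) with ⇒-subst⁻ t σ r
  ... | inj₂ (t′ , z , _ , r′ , hz , stτ , r₁) =
        inj₂ ([] , b ∷ s , z , refl , (t′ , done r′ , hz) , step (⇒-step stτ r₁) st w)
  ... | inj₁ (t₁ , r′ , refl) with ─→-subst⁻ t₁ σ st
  ...   | inj₂ (z , hz , st′) = inj₂ ([] , b ∷ s , z , refl , (t₁ , done r′ , hz) , step ⇒-refl st′ w)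
  ...   | inj₁ (t₂ , st′ , refl) with WPath-subst⁻ t₂ σ w
  ...     | inj₁ (t′ , w′ , e) = inj₁ (t′ , step r′ st′ w′ , e)
  ...     | inj₂ (s₁ , s₂ , z , e , (t′ , w′ , hz) , wz) =
            inj₂ (b ∷ s₁ , s₂ , z , cong (b ∷_) e , (t′ , step r′ st′ w′ , hz) , wz)

  HasTrace-subst⁻ : ∀ t (σ : Subst) {w} → HasTrace (t [ σ ]) w →
                    HasTrace t w ⊎
                    (∃ λ s → ∃ λ r → ∃ λ z → s ++ r ≡ w × HasVarTrace t s z × HasTrace (σ z) r)
  HasTrace-subst⁻ t σ (q , w) with WPath-subst⁻ t σ w
  ... | inj₁ (t′ , w′ , _)              = inj₁ (t′ , w′)
  ... | inj₂ (s , r , z , e , vt , wz) = inj₂ (s , r , z , e , vt , q , wz)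

  HasVarTrace-subst⁻ : ∀ t (σ : Subst) {w x} → HasVarTrace (t [ σ ]) w x →
                       ∃ λ s → ∃ λ r → ∃ λ z → s ++ r ≡ w × HasVarTrace t s z × HasVarTrace (σ z) r x
  HasVarTrace-subst⁻ t σ {w} (q , wq , hx) with WPath-subst⁻ t σ wq
  ... | inj₂ (s , r , z , e , vt , wz) = s , r , z , e , vt , q , wz , hx
  ... | inj₁ (t′ , w′ , refl) with HasVar-subst⁻ t′ σ hx
  ...   | z , hz , hzx = w , [] , z , ++-identityʳ w , (t′ , w′ , hz) , σ z , done ⇒-refl , hzx

  NoτSubst : Subst → Set
  NoτSubst σ = ∀ z {q} → ¬ (σ z ─[ τ ]→ q)

  ⇒-subst⁻-noτ : ∀ {σ} → NoτSubst σ → ∀ t {q} → (t [ σ ]) ⇒ q → ∃ λ t′ → t ⇒ t′ × q ≡ t′ [ σ ]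
  ⇒-subst⁻-noτ {σ} noτ t r with ⇒-subst⁻ t σ r
  ... | inj₁ res                          = res
  ... | inj₂ (_ , z , _ , _ , _ , st , _) = ⊥-elim (noτ z st)

  ⊑WIF-subst-HasTrace⁺ : ∀ {t u σ s} → t ⊑WIF u → ClosedSubst σ →
                         HasTrace (t [ σ ]) s → HasTrace (u [ σ ]) s
  ⊑WIF-subst-HasTrace⁺ {s = s} t⊑u closed = proj₁ (proj₁ (proj₂ (t⊑u _ closed)) s)

  ⊑WIF-subst-HasTrace⁻ : ∀ {t u σ s} → t ⊑WIF u → ClosedSubst σ →
                         HasTrace (u [ σ ]) s → HasTrace (t [ σ ]) s
  ⊑WIF-subst-HasTrace⁻ {s = s} t⊑u closed = proj₂ (proj₁ (proj₂ (t⊑u _ closed)) s)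

  ⊑WIF-HasTrace⁻ : ∀ {t u s} → t ⊑WIF u → HasTrace u s → HasTrace t s
  ⊑WIF-HasTrace⁻ {t} {u} t⊑u tr
    with HasTrace-subst⁻ t (const 𝟎)
           (⊑WIF-subst-HasTrace⁻ {t} {u} t⊑u (const 𝟎c) (HasTrace-subst⁺ (const 𝟎) tr))
  ... | inj₁ trt = trt
  ... | inj₂ (s′ , r , _ , e , (t′ , w , _) , tr𝟎) with HasTrace-𝟎⁻ tr𝟎
  ...   | refl = t′ , Eq.subst (λ l → WPath t l t′) (Eq.trans (sym (++-identityʳ s′)) e) w

  ⊑WIF-─τ→ : ∀ {t u t′} → t ⊑WIF u → t ─[ τ ]→ t′ → ∃ λ u′ → u ─[ τ ]→ u′
  ⊑WIF-─τ→ {u = u} t⊑u st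
    with proj₂ (proj₂ (t⊑u (const 𝟎) (const 𝟎c))) (_ , ─→-subst⁺ (const 𝟎) st)
  ... | _ , st′ with ─→-subst⁻ u (const 𝟎) st′
  ...   | inj₁ (u′ , st″ , _) = u′ , st″
  ...   | inj₂ (_ , _ , ())

module Encoding (A : Set) (c d : A) (c≢d : c ≢ d) where
  open BCCS A
  open Semantics A

  dⁿc : ℕ → Term
  dⁿc zero    = vis c · 𝟎
  dⁿc (suc n) = vis d · dⁿc n

  encode : ℕ → Subst
  encode K z = vis c · dⁿc (K + z)

  code : ℕ → List A
  code n = c ∷ replicate n d ++ c ∷ []

  encode-closed : ∀ K → ClosedSubst (encode K)
  encode-closed K z = ·c (dⁿc-closed (K + z))
    where
    dⁿc-closed : ∀ n → Closed (dⁿc n)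
    dⁿc-closed zero    = ·c 𝟎c
    dⁿc-closed (suc n) = ·c (dⁿc-closed n)

  encode-noτ : ∀ K → NoτSubst (encode K)
  encode-noτ K z ()

  c∉replicate : ∀ j → c ∉ replicate j d
  c∉replicate (suc j) (here c≡d)   = c≢d c≡d
  c∉replicate (suc j) (there c∈ds) = c∉replicate j c∈ds

  HasTrace-dⁿc : ∀ n → HasTrace (dⁿc n) (replicate n d ++ c ∷ [])
  HasTrace-dⁿc zero    = 𝟎 , step ⇒-refl pre (done ⇒-refl)
  HasTrace-dⁿc (suc n) with HasTrace-dⁿc n
  ... | q , w = q , step ⇒-refl pre w

  HasTrace-dⁿc⁻ : ∀ n {r} → HasTrace (dⁿc n) r →
                  (∃ λ j → r ≡ replicate j d) ⊎ r ≡ replicate n d ++ c ∷ []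
  HasTrace-dⁿc⁻ zero tr with HasTrace-vis·⁻ tr
  ... | inj₁ refl = inj₁ (0 , refl)
  ... | inj₂ (_ , refl , tr′) with HasTrace-𝟎⁻ tr′
  ...   | refl = inj₂ refl
  HasTrace-dⁿc⁻ (suc n) tr with HasTrace-vis·⁻ tr
  ... | inj₁ refl = inj₁ (0 , refl)
  ... | inj₂ (_ , refl , tr′) with HasTrace-dⁿc⁻ n tr′
  ...   | inj₁ (j , refl) = inj₁ (suc j , refl)
  ...   | inj₂ refl        = inj₂ refl

  HasTrace-encode⁻ : ∀ K z {r} → HasTrace (encode K z) r →
                     r ≡ [] ⊎ (∃ λ j → r ≡ c ∷ replicate j d) ⊎ r ≡ code (K + z)
  HasTrace-encode⁻ K z tr with HasTrace-vis·⁻ tr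
  ... | inj₁ e = inj₁ e
  ... | inj₂ (_ , refl , tr′) with HasTrace-dⁿc⁻ (K + z) tr′
  ...   | inj₁ (j , refl) = inj₂ (inj₁ (j , refl))
  ...   | inj₂ refl        = inj₂ (inj₂ refl)

  HasVarTrace-encode : ∀ {p s z} K → HasVarTrace p s z → HasTrace (p [ encode K ]) (s ++ code (K + z))
  HasVarTrace-encode {z = z} K vt with HasTrace-dⁿc (K + z)
  ... | q , w = HasTrace-subst-var (encode K) vt (q , step ⇒-refl pre w)

  ++-code : ∀ s n → s ++ code n ≡ (s ++ c ∷ replicate n d) ++ c ∷ []
  ++-code s n = sym (++-assoc s (c ∷ replicate n d) (c ∷ []))

  ++-code-injective : ∀ s′ s {n′ n} → s′ ++ code n′ ≡ s ++ code n → s′ ≡ s × n′ ≡ n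
  ++-code-injective s′ s {n′} {n} e
    with ++-∷-injective s′ s (c∉replicate n′) (c∉replicate n)
           (∷ʳ-injectiveˡ _ _ (Eq.trans (sym (++-code s′ n′)) (Eq.trans e (++-code s n))))
  ... | s′≡s , ds≡ =
        s′≡s , Eq.trans (sym (length-replicate n′)) (Eq.trans (cong length ds≡) (length-replicate n))

  ++-code-prefix : ∀ s′ s j {n} → s′ ++ c ∷ replicate j d ≡ s ++ code n → s′ ≡ s ++ c ∷ replicate n d
  ++-code-prefix s′ s j {n} e =
    proj₁ (++-∷-injective s′ (s ++ c ∷ replicate n d) (c∉replicate j) (λ ())
             (Eq.trans e (++-code s n)))

  code-too-long : ∀ {K s′} s z ys → length s′ ≤ K → ¬ s′ ≡ s ++ c ∷ replicate (K + z) d ++ ys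
  code-too-long {K} s z ys s′≤K refl =
    <⇒≱ (≤-trans (s≤s (m≤m+n K z)) (<-length-∷-replicate s (K + z) ys)) s′≤K

  -- A trace of p [ encode K ] ending in code (K + z) cannot be a trace of p (too long), so it
  -- passes through a variable z′ and ends in a trace of encode K z′; comparing the blocks of d's
  -- delimited by the last two c's gives z′ = z.
  HasVarTrace-decode : ∀ {p K s z} → depth p ≤ K → HasTrace (p [ encode K ]) (s ++ code (K + z)) →
                       HasVarTrace p s z
  HasVarTrace-decode {p} {K} {s} {z} p≤K tr with HasTrace-subst⁻ p (encode K) tr
  ... | inj₁ (_ , w) = ⊥-elim (code-too-long s z (c ∷ []) (≤-trans (length≤depth w) p≤K) refl)
  ... | inj₂ (s′ , r , z′ , e , vt@(_ , w , _) , trz′) = decode (HasTrace-encode⁻ K z′ trz′)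
    where
    too-long : ∀ ys → ¬ s′ ≡ s ++ c ∷ replicate (K + z) d ++ ys
    too-long ys = code-too-long s z ys (≤-trans (length≤depth w) p≤K)

    decode : r ≡ [] ⊎ (∃ λ j → r ≡ c ∷ replicate j d) ⊎ r ≡ code (K + z′) → HasVarTrace p s z
    decode (inj₁ refl) = ⊥-elim (too-long (c ∷ []) (Eq.trans (sym (++-identityʳ s′)) e))
    decode (inj₂ (inj₁ (j , refl))) =
      ⊥-elim (too-long [] (Eq.trans (++-code-prefix s′ s j e)
                                    (cong (λ l → s ++ c ∷ l) (sym (++-identityʳ _)))))
    decode (inj₂ (inj₂ refl)) with ++-code-injective s′ s e
    ... | refl , K+z′≡K+z with +-cancelˡ-≡ K z′ z K+z′≡K+z
    ...   | refl = vt

  ⊑WIF-HasVarTrace⁺ : ∀ {t u s z} → t ⊑WIF u → HasVarTrace t s z → HasVarTrace u s z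
  ⊑WIF-HasVarTrace⁺ {t} {u} t⊑u vt =
    HasVarTrace-decode ≤-refl
      (⊑WIF-subst-HasTrace⁺ {t} {u} t⊑u (encode-closed (depth u)) (HasVarTrace-encode (depth u) vt))

  ⊑WIF-HasVarTrace⁻ : ∀ {t u s z} → t ⊑WIF u → HasVarTrace u s z → HasVarTrace t s z
  ⊑WIF-HasVarTrace⁻ {t} {u} t⊑u vt =
    HasVarTrace-decode ≤-refl
      (⊑WIF-subst-HasTrace⁻ {t} {u} t⊑u (encode-closed (depth t)) (HasVarTrace-encode (depth t) vt))

  -- The weak impossible future ([] , traces not of t̂) of t, read through the encoding.
  ⊑WIF-⇒ : ∀ {t u t̂} → t ⊑WIF u → t ⇒ t̂ →
           ∃ λ û → u ⇒ û × (∀ s z → ¬ HasVarTrace t̂ s z → ¬ HasVarTrace û s z)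
  ⊑WIF-⇒ {t} {u} {t̂} t⊑u t⇒t̂
    with proj₁ (t⊑u ρ (encode-closed K)) [] (λ w → ¬ HasTrace (t̂ [ ρ ]) w)
           (t̂ [ ρ ] , done (⇒-subst⁺ ρ t⇒t̂) , λ _ ∉t̂ ∈t̂ → ∉t̂ ∈t̂)
    where
    K = depth t̂
    ρ = encode K
  ... | _ , done uρ⇒q , refuses with ⇒-subst⁻-noτ (encode-noτ (depth t̂)) u uρ⇒q
  ...   | û , u⇒û , refl =
          û , u⇒û , λ s z ∉t̂ ∈û →
            refuses _ (∉t̂ ∘ HasVarTrace-decode ≤-refl) (HasVarTrace-encode (depth t̂) ∈û)

module Invariant (A : Set) (c d : A) (c≢d : c ≢ d) (a : A) (m : ℕ) where
  open BCCS A
  open Semantics A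
  open Encoding A c d c≢d

  CleanAfterτ : Term → Set
  CleanAfterτ t = ∃ λ t̂ → t ⇒τ t̂ × NoBadTrace a m t̂

  NoBadTrace-─τ→ : ∀ {t t′} → t ─[ τ ]→ t′ → NoBadTrace a m t → NoBadTrace a m t′
  NoBadTrace-─τ→ st (noVar , noLong) =
    (λ x (q , w , hx) → noVar x (q , ⇒-WPath (⇒-step st ⇒-refl) w , hx)) ,
    (λ b (q , w) → noLong b (q , ⇒-WPath (⇒-step st ⇒-refl) w))

  NoBadTrace-⊑WIF : ∀ {p q} → p ⊑WIF q → NoBadTrace a m p → NoBadTrace a m q
  NoBadTrace-⊑WIF p⊑q (noVar , noLong) =
    (λ x → noVar x ∘ ⊑WIF-HasVarTrace⁻ p⊑q) , (λ b → noLong b ∘ ⊑WIF-HasTrace⁻ p⊑q)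

  NoBadTrace-subst-mono : ∀ {t û} (σ : Subst) → depth û ≤ m →
                          (∀ s z → ¬ HasVarTrace t s z → ¬ HasVarTrace û s z) →
                          NoBadTrace a m (t [ σ ]) → NoBadTrace a m (û [ σ ])
  NoBadTrace-subst-mono {t} {û} σ û≤m fewer (noVar , noLong) = noVar′ , noLong′
    where
    noVar′ : ∀ x → ¬ HasVarTrace (û [ σ ]) (a ∷ []) x
    noVar′ x vt with HasVarTrace-subst⁻ û σ vt
    ... | s , r , z , e , vtû , vtz =
          fewer s z (λ vtt → noVar x (Eq.subst (λ w → HasVarTrace (t [ σ ]) w x) e
                                        (HasVarTrace-subst-var σ vtt vtz))) vtû

    noLong′ : ∀ b → ¬ HasTrace (û [ σ ]) (replicate m a ++ b ∷ [])
    noLong′ b tr with HasTrace-subst⁻ û σ tr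
    ... | inj₁ (_ , w) = <⇒≱ (<-length-replicate-∷ m []) (≤-trans (length≤depth w) û≤m)
    ... | inj₂ (s , r , z , e , vtû , trz) =
          fewer s z (λ vtt → noLong b (Eq.subst (HasTrace (t [ σ ])) e
                                         (HasTrace-subst-var σ vtt trz))) vtû

  CleanAfterτ-axiom : ∀ {t u} → t ⊑WIF u → depth u ≤ m →
                      ∀ σ → CleanAfterτ (t [ σ ]) → CleanAfterτ (u [ σ ])
  CleanAfterτ-axiom {t} {u} t⊑u u≤m σ (v̂ , tσ⇒τv̂ , clean) with ⇒τ-subst⁻ t σ tσ⇒τv̂
  ... | inj₂ (t′ , z , t⇒t′ , hz , σz⇒τv̂) with ⊑WIF-HasVarTrace⁺ {u = u} t⊑u (t′ , done t⇒t′ , hz)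
  ...   | _ , done u⇒u′ , hz′ = v̂ , ⇒-⇒τ (⇒-subst⁺ σ u⇒u′) (⇒τ-var σ hz′ σz⇒τv̂) , clean
  CleanAfterτ-axiom {t} {u} t⊑u u≤m σ (_ , _ , clean) | inj₁ (t̂ , t⇒τt̂ , refl)
    with ⊑WIF-⇒ {u = u} t⊑u (⇒τ⇒⇒ t⇒τt̂)
  ... | û , u⇒û , fewer with NoBadTrace-subst-mono σ (≤-trans (depth-⇒ u⇒û) u≤m) fewer clean
                           | ⇒-split u⇒û
  ...   | cleanû | inj₂ u⇒τû = û [ σ ] , ⇒τ-subst⁺ σ u⇒τû , cleanû
  ...   | cleanû | inj₁ refl with ⊑WIF-─τ→ {u = u} t⊑u (proj₂ (⇒τ-head t⇒τt̂))
  ...     | u₁ , u─τ→u₁ = u₁ [ σ ] , (u [ σ ] , ⇒-refl , uσ─τ→u₁σ) , NoBadTrace-─τ→ uσ─τ→u₁σ cleanû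
    where
    uσ─τ→u₁σ = ─→-subst⁺ σ u─τ→u₁

  module _ {E : Term → Term → Set} (sound : Sound E) (bounded : ∀ t u → E t u → depth u ≤ m) where

    CleanAfterτ-derivable : ∀ {t u} → Derivable E t u →
                            ∀ σ → CleanAfterτ (t [ σ ]) → CleanAfterτ (u [ σ ])
    CleanAfterτ-derivable (ax {t} {u} e) =
      CleanAfterτ-axiom {t} {u} (sound t u (ax e)) (bounded t u e)
    CleanAfterτ-derivable refl σ clean = clean
    CleanAfterτ-derivable (trans d₁ d₂) σ = CleanAfterτ-derivable d₂ σ ∘ CleanAfterτ-derivable d₁ σ
    CleanAfterτ-derivable (subst {t} {u} σ′ d) σ =
      Eq.subst CleanAfterτ (sym (subst-∘ u σ′ σ)) ∘ CleanAfterτ-derivable d _ ∘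
      Eq.subst CleanAfterτ (subst-∘ t σ′ σ)
    CleanAfterτ-derivable (pref α d) σ (_ , (_ , ⇒-refl , pre) , clean) =
      _ , (_ , ⇒-refl , pre) , NoBadTrace-⊑WIF (sound _ _ (subst σ d)) clean
    CleanAfterτ-derivable (pref α d) σ (v̂ , (v , ⇒-step pre t⇒v , st) , clean) =
      map₂ (map₁ (⇒-⇒τ (⇒-step pre ⇒-refl))) (CleanAfterτ-derivable d σ (v̂ , (v , t⇒v , st) , clean))
    CleanAfterτ-derivable (plus d₁ d₂) σ (v̂ , h , clean) with ⇒τ-⊕⁻ h
    ... | inj₁ h₁ = map₂ (map₁ ⇒τ-⊕ˡ) (CleanAfterτ-derivable d₁ σ (v̂ , h₁ , clean))
    ... | inj₂ h₂ = map₂ (map₁ ⇒τ-⊕ʳ) (CleanAfterτ-derivable d₂ σ (v̂ , h₂ , clean))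

lemma13 : (A : Set) → let open BCCS A in
    (∃ λ (c : A) → ∃ λ (d : A) → c ≢ d) →
    (E : Term → Term → Set) → Sound E →
    (v w : Term) (a : A) (m : ℕ) →
    Derivable E v w →
    (∀ t u → E t u → depth u ≤ m) →
    (∃ λ v̂ → (v ⇒τ v̂) × NoBadTrace a m v̂) →
    ∃ λ ŵ → (w ⇒τ ŵ) × NoBadTrace a m ŵ
lemma13 A (c , d , c≢d) E sound v w a m v≼w bounded clean =
  Eq.subst CleanAfterτ (subst-identity w)
    (CleanAfterτ-derivable sound bounded v≼w var
      (Eq.subst CleanAfterτ (sym (subst-identity v)) clean))
  where
  open BCCS A using (var)
  open Semantics A
  open Invariant A c d c≢d a m
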